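{- For every even binary word $W$ with at most four occurrences of $\mathtt{1}$, there exists a cyclic permutation $\gamma$ such that the word $\gamma(W)$ is a shuffle square.
   Context: Binary words are over the alphabet $\{\mathtt{0},\mathtt{1}\}$. A word is \emph{even} if every letter occurs in it an even number of times. For a permutation $\gamma=\gamma_1\cdots\gamma_n$ of $[n]$ (written as a sequence) and a word $W=w_1\cdots w_n$, $\gamma(W)=w_{\gamma_1}\cdots w_{\gamma_n}$. A permutation $\gamma$ of $[n]$ is \emph{cyclic} if $\gamma=i(i+1)\cdots n\,1\,2\cdots(i-1)$ for some $i\in[n]$; thus $\gamma(W)$ is a cyclic shift of $W$, i.e. $\gamma(W)=YX$ where $W=XY$. A \emph{shuffle square} is a word whose positions can be partitioned into two sets so that the two resulting subwords (words obtained by keeping the letters at those positions, in order) are identical. -}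

module Defs where

open import Data.Bool using (Bool; true; false; not)
open import Data.Nat using (ℕ; zero; suc; _≤_)
open import Data.Nat.Divisibility using (_∣_)
open import Data.List using (List; []; _∷_; _++_; length)
open import Data.Product using (Σ; ∃; _×_; _,_)
open import Relation.Binary.PropositionalEquality using (_≡_)

data Bit : Set where
  𝟎 𝟏 : Bit

Word : Set
Word = List Bit

count : Bit → Word → ℕ
count b [] = 0
count 𝟎 (𝟎 ∷ w) = suc (count 𝟎 w)
count 𝟎 (𝟏 ∷ w) = count 𝟎 w
count 𝟏 (𝟎 ∷ w) = count 𝟏 w
count 𝟏 (𝟏 ∷ w) = suc (count 𝟏 w)

Even : Word → Set
Even w = (b : Bit) → 2 ∣ count b w

-- The subword of w consisting of the letters at the positions i with
-- m_i = c (a labelling m of the positions; extra labels are ignored).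
subword : Bool → List Bool → Word → Word
subword c _ [] = []
subword c [] (_ ∷ _) = []
subword true  (true  ∷ m) (x ∷ w) = x ∷ subword true m w
subword true  (false ∷ m) (x ∷ w) = subword true m w
subword false (true  ∷ m) (x ∷ w) = subword false m w
subword false (false ∷ m) (x ∷ w) = x ∷ subword false m w

-- shuffle square: the positions of w can be partitioned into two sets
-- (a labelling m with one label per position) such that the two resulting
-- subwords are identical
ShuffleSquare : Word → Set
ShuffleSquare w =
  Σ (List Bool) λ m → (length m ≡ length w) × (subword true m w ≡ subword false m w)

-- γ(W) for the cyclic permutation γ = i (i+1) ⋯ n 1 ⋯ (i-1):
-- the cyclic shift Y X of W = X Y
IsCyclicShiftOf : Word → Word → Set
IsCyclicShiftOf v w = Σ Word λ x → Σ Word λ y → (w ≡ x ++ y) × (v ≡ y ++ x)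

-- A word is, up to cyclic shift, determined by its cyclic gap sequence: the number of 0s in
-- front of each 1, the 0s after the last 1 being absorbed into the first gap.  The block
-- 0^m 1 0^(j+m) 1 0^(j+2e) is a shuffle square (both copies are 0^m 1 0^j 0^e), and a cyclic
-- shift of two concatenated blocks has gaps (j+m, j+m′+2e, m′+j′, m+j′+2e′).  Given four gaps
-- (a, b, c, d) with even sum, rotate so that a + c ≤ b + d; then a + c splits as s + r with
-- s ≤ b, r ≤ d and b − s, d − r even, and a 2×2 table with row sums a, c and column sums s, r
-- provides j, m, m′, j′.  The split fails only for a = c = 0 with b, d odd, i.e. for
-- 11 0^b 11 0^(b+2t) up to rotation, which is the shuffle square of 1 1 0^b 0^t.  With two 1s,
-- 0^(j+2e) 1 0^j 1 is the shuffle square of 0^(j+e) 1; with none, 0^(2h) is that of 0^h.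

module Submission where

open import Defs
open import Algebra.Properties.CommutativeSemigroup using (xy∙z≈xz∙y; x∙yz≈y∙xz)
open import Data.Bool using (Bool; true; false)
open import Data.List using (List; []; _∷_; _++_; length; replicate)
open import Data.List.Properties using (++-assoc; ++-identityʳ; ∷-injective)
open import Data.List.Relation.Ternary.Interleaving.Propositional
  using (Interleaving; []; consˡ; consʳ)
open import Data.Nat using (ℕ; zero; suc; _+_; _*_; _≤_; s≤s)
open import Data.Nat.Divisibility using (_∣_; divides; ∣-refl; ∣m∣n⇒∣m+n; ∣m+n∣m⇒∣n; ∣1⇒≡1)
open import Data.Nat.ListAction using (sum)
open import Data.Nat.ListAction.Properties using (sum-++)
open import Data.Nat.Properties
  using (+-suc; +-assoc; +-comm; +-identityʳ; *-suc; *-identityʳ; suc-injective; ≤-total;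
         m≤n⇒∃[o]m+o≡n; m+n≡0⇒m≡0; m+n≡0⇒n≡0; +-commutativeSemigroup)
open import Data.Product using (Σ; ∃; _×_; _,_)
open import Data.Sum using (_⊎_; inj₁; inj₂)
open import Relation.Nullary using (¬_)
open import Relation.Binary.PropositionalEquality

private
  variable
    A : Set
    p q : ℕ
    us vs u v w : Word

n+n≡n*2 : ∀ n → n + n ≡ n * 2
n+n≡n*2 n = sym (trans (*-suc n 1) (cong (n +_) (*-identityʳ n)))

2∣n+n : ∀ n → 2 ∣ n + n
2∣n+n n = divides n (n+n≡n*2 n)

halve : 2 ∣ p → ∃ λ h → p ≡ h + h
halve (divides h eq) = h , trans eq (sym (n+n≡n*2 h))

halve-odd : 2 ∣ suc p → ∃ λ h → p ≡ suc (h + h)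
halve-odd 2∣1+p with halve 2∣1+p
... | suc h , eq = h , trans (suc-injective eq) (+-suc h h)

even-or-odd : ∀ n → 2 ∣ n ⊎ 2 ∣ suc n
even-or-odd zero = inj₁ (divides 0 refl)
even-or-odd (suc n) with even-or-odd n
... | inj₁ 2∣n   = inj₂ (∣m∣n⇒∣m+n ∣-refl 2∣n)
... | inj₂ 2∣1+n = inj₁ 2∣1+n

odd-transfer : 2 ∣ p + q → 2 ∣ suc p → 2 ∣ suc q
odd-transfer {p} {q} 2∣p+q 2∣1+p = ∣m+n∣m⇒∣n 2∣2+p+q 2∣1+p
  where
  2∣2+p+q : 2 ∣ suc p + suc q
  2∣2+p+q = subst (2 ∣_) (sym (cong suc (+-suc p q))) (∣m∣n⇒∣m+n ∣-refl 2∣p+q)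

¬2∣1 : ¬ 2 ∣ 1
¬2∣1 2∣1 with () ← ∣1⇒≡1 2∣1

¬2∣3 : ¬ 2 ∣ 3
¬2∣3 2∣3 = ¬2∣1 (∣m+n∣m⇒∣n 2∣3 ∣-refl)

even-surplus : p ≤ q → 2 ∣ p + q → ∃ λ t → q ≡ p + (t + t)
even-surplus {p} p≤q 2∣p+q with o , refl ← m≤n⇒∃[o]m+o≡n p≤q =
  let t , o≡t+t = halve (∣m+n∣m⇒∣n (subst (2 ∣_) (sym (+-assoc p p o)) 2∣p+q) (2∣n+n p))
  in  t , cong (p +_) o≡t+t

record EvenDistribution (n b d : ℕ) : Set where
  constructor distribution
  field
    s r e e′ : ℕ
    s+r≡n    : s + r ≡ n
    b≡s+2e   : b ≡ s + (e + e)
    d≡r+2e′  : d ≡ r + (e′ + e′)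

distribute : ∀ n b d t → b + d ≡ n + (t + t) → EvenDistribution n b d ⊎ (n ≡ 0 × 2 ∣ suc b)
distribute zero b d t eq with even-or-odd b
... | inj₂ 2∣1+b = inj₂ (refl , 2∣1+b)
... | inj₁ 2∣b
  with e , refl ← halve 2∣b
  with e′ , refl ← halve (∣m+n∣m⇒∣n (subst (2 ∣_) (sym eq) (2∣n+n t)) 2∣b)
  = inj₁ (distribution 0 0 e e′ refl refl refl)
distribute (suc n) zero d t eq = inj₁ (distribution 0 (suc n) 0 t refl refl eq)
distribute (suc n) (suc b) d t eq with distribute n b d t (suc-injective eq)
... | inj₁ (distribution s r e e′ s+r≡n b≡ d≡) =
  inj₁ (distribution (suc s) r e e′ (cong suc s+r≡n) (cong suc b≡) d≡)
... | inj₂ (refl , 2∣1+b)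
  with e , 1+b≡e+e ← halve 2∣1+b
  with e′ , refl ← halve-odd (odd-transfer (subst (2 ∣_) (sym (suc-injective eq)) (2∣n+n t)) 2∣1+b)
  = inj₁ (distribution 0 1 e e′ refl 1+b≡e+e refl)

record Table (a c s r : ℕ) : Set where
  constructor table
  field
    j m m′ j′ : ℕ
    a≡j+m     : a ≡ j + m
    c≡m′+j′   : c ≡ m′ + j′
    s≡j+m′    : s ≡ j + m′
    r≡m+j′    : r ≡ m + j′

table-with-margins : ∀ a c s r → s + r ≡ a + c → Table a c s r
table-with-margins zero    c s       r eq = table 0 0 s r refl (sym eq) refl refl
table-with-margins (suc a) c zero    r eq = table 0 (suc a) 0 c refl refl refl eq
table-with-margins (suc a) c (suc s) r eq
  with table j m m′ j′ a≡ c≡ s≡ r≡ ← table-with-margins a c s r (suc-injective eq)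
  = table (suc j) m m′ j′ (cong suc a≡) c≡ (cong suc s≡) r≡

zeros : ℕ → Word
zeros n = replicate n 𝟎

zeros-++ : ∀ m n w → zeros m ++ zeros n ++ w ≡ zeros (m + n) ++ w
zeros-++ zero    n w = refl
zeros-++ (suc m) n w = cong (𝟎 ∷_) (zeros-++ m n w)

zeros-++-++ : ∀ a b c w → zeros a ++ zeros b ++ zeros c ++ w ≡ zeros (a + (b + c)) ++ w
zeros-++-++ a b c w = trans (cong (zeros a ++_) (zeros-++ b c w)) (zeros-++ a (b + c) w)

necklace : List ℕ → Word → Word
necklace []       w = w
necklace (g ∷ gs) w = zeros g ++ 𝟏 ∷ necklace gs w

necklace-++ : ∀ gs hs w → necklace (gs ++ hs) w ≡ necklace gs (necklace hs w)
necklace-++ []       hs w = refl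
necklace-++ (g ∷ gs) hs w = cong (λ v → zeros g ++ 𝟏 ∷ v) (necklace-++ gs hs w)

necklace-[]-++ : ∀ gs w → necklace gs [] ++ w ≡ necklace gs w
necklace-[]-++ []       w = refl
necklace-[]-++ (g ∷ gs) w =
  trans (++-assoc (zeros g) (𝟏 ∷ necklace gs []) w)
        (cong (λ v → zeros g ++ 𝟏 ∷ v) (necklace-[]-++ gs w))

necklace-decomposition : ∀ w → Σ (List ℕ) λ gs → Σ ℕ λ z →
  w ≡ necklace gs (zeros z) × count 𝟏 w ≡ length gs × count 𝟎 w ≡ sum gs + z
necklace-decomposition [] = [] , 0 , refl , refl , refl
necklace-decomposition (𝟏 ∷ w)
  with gs , z , refl , c₁ , c₀ ← necklace-decomposition w
  = 0 ∷ gs , z , refl , cong suc c₁ , c₀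
necklace-decomposition (𝟎 ∷ w) with necklace-decomposition w
... | []     , z , refl , c₁ , c₀ = []         , suc z , refl , c₁ , cong suc c₀
... | g ∷ gs , z , refl , c₁ , c₀ = suc g ∷ gs , z     , refl , c₁ , cong suc c₀

sum-absorb : ∀ g gs z → sum (g + z ∷ gs) ≡ sum (g ∷ gs) + z
sum-absorb g gs z = xy∙z≈xz∙y +-commutativeSemigroup g z (sum gs)

sum-rotate : ∀ gs hs → sum (gs ++ hs) ≡ sum (hs ++ gs)
sum-rotate gs hs = trans (sum-++ gs hs) (trans (+-comm (sum gs) (sum hs)) (sym (sum-++ hs gs)))

++-split : ∀ (xs ys us vs : List A) → xs ++ ys ≡ us ++ vs →
  (∃ λ zs → xs ≡ us ++ zs × vs ≡ zs ++ ys) ⊎ (∃ λ zs → us ≡ xs ++ zs × ys ≡ zs ++ vs)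
++-split []       ys us       vs eq = inj₂ (us , refl , eq)
++-split (x ∷ xs) ys []       vs eq = inj₁ (x ∷ xs , refl , sym eq)
++-split (x ∷ xs) ys (u ∷ us) vs eq with refl , eq′ ← ∷-injective eq
  with ++-split xs ys us vs eq′
... | inj₁ (zs , refl , vs≡) = inj₁ (zs , refl , vs≡)
... | inj₂ (zs , refl , ys≡) = inj₂ (zs , refl , ys≡)

shift-refl : ∀ w → IsCyclicShiftOf w w
shift-refl w = [] , w , refl , sym (++-identityʳ w)

shift-sym : IsCyclicShiftOf v w → IsCyclicShiftOf w v
shift-sym (x , y , w≡x++y , v≡y++x) = y , x , v≡y++x , w≡x++y

shift-trans : IsCyclicShiftOf v u → IsCyclicShiftOf u w → IsCyclicShiftOf v w
shift-trans (x′ , y′ , refl , refl) (x , y , refl , x′++y′≡y++x)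
  with ++-split y x x′ y′ (sym x′++y′≡y++x)
... | inj₁ (z , refl , refl) = x ++ x′ , z , sym (++-assoc x x′ z) , ++-assoc z x x′
... | inj₂ (z , refl , refl) = z , y′ ++ y , ++-assoc z y′ y , sym (++-assoc y′ y z)

necklace-rotate : ∀ gs hs → IsCyclicShiftOf (necklace (hs ++ gs) []) (necklace (gs ++ hs) [])
necklace-rotate gs hs = necklace gs [] , necklace hs [] , split gs hs , split hs gs
  where
  split : ∀ gs hs → necklace (gs ++ hs) [] ≡ necklace gs [] ++ necklace hs []
  split gs hs = trans (necklace-++ gs hs []) (sym (necklace-[]-++ gs (necklace hs [])))

necklace-absorb : ∀ z g gs →
  IsCyclicShiftOf (necklace (g + z ∷ gs) []) (necklace (g ∷ gs) (zeros z))
necklace-absorb z g gs =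
  necklace (g ∷ gs) [] , zeros z ,
  sym (necklace-[]-++ (g ∷ gs) (zeros z)) ,
  trans (cong (λ k → zeros k ++ 𝟏 ∷ necklace gs []) (+-comm g z)) (sym (zeros-++ z g _))

HasSquareShift : Word → Set
HasSquareShift w = Σ Word λ v → IsCyclicShiftOf v w × ShuffleSquare v

hasSquareShift-shift : IsCyclicShiftOf u w → HasSquareShift u → HasSquareShift w
hasSquareShift-shift u~w (v , v~u , square) = v , shift-trans v~u u~w , square

square⇒hasSquareShift : ShuffleSquare w → HasSquareShift w
square⇒hasSquareShift {w} square = w , shift-refl w , square

labels : Interleaving us vs w → List Bool
labels []         = []
labels (consˡ sp) = true  ∷ labels sp
labels (consʳ sp) = false ∷ labels sp

length-labels : (sp : Interleaving us vs w) → length (labels sp) ≡ length w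
length-labels []         = refl
length-labels (consˡ sp) = cong suc (length-labels sp)
length-labels (consʳ sp) = cong suc (length-labels sp)

subword-labelsˡ : (sp : Interleaving us vs w) → subword true (labels sp) w ≡ us
subword-labelsˡ []         = refl
subword-labelsˡ (consˡ sp) = cong (_ ∷_) (subword-labelsˡ sp)
subword-labelsˡ (consʳ sp) = subword-labelsˡ sp

subword-labelsʳ : (sp : Interleaving us vs w) → subword false (labels sp) w ≡ vs
subword-labelsʳ []         = refl
subword-labelsʳ (consˡ sp) = subword-labelsʳ sp
subword-labelsʳ (consʳ sp) = cong (_ ∷_) (subword-labelsʳ sp)

interleaving⇒shuffleSquare : Interleaving u u w → ShuffleSquare w
interleaving⇒shuffleSquare sp =
  labels sp , length-labels sp , trans (subword-labelsˡ sp) (sym (subword-labelsʳ sp))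

zerosˡ : ∀ n → Interleaving us vs w → Interleaving (zeros n ++ us) vs (zeros n ++ w)
zerosˡ zero    sp = sp
zerosˡ (suc n) sp = consˡ (zerosˡ n sp)

zerosʳ : ∀ n → Interleaving us vs w → Interleaving us (zeros n ++ vs) (zeros n ++ w)
zerosʳ zero    sp = sp
zerosʳ (suc n) sp = consʳ (zerosʳ n sp)

zeros-square : ∀ h → ShuffleSquare (zeros (h + h))
zeros-square h =
  subst ShuffleSquare (trans (zeros-++ h h []) (++-identityʳ _))
        (interleaving⇒shuffleSquare (zerosˡ h (zerosʳ h [])))

oneBlock-square : ∀ j e → ShuffleSquare (necklace (e + (e + j) ∷ j ∷ []) [])
oneBlock-square j e =
  subst ShuffleSquare (zeros-++-++ e e j _)
        (interleaving⇒shuffleSquare (zerosˡ e (zerosʳ e (zerosˡ j (consˡ (zerosʳ j (consʳ [])))))))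

pairs-square : ∀ a c → ShuffleSquare (necklace (0 ∷ 0 ∷ a ∷ 0 ∷ []) (zeros (a + (c + c))))
pairs-square a c =
  subst ShuffleSquare
        (cong (λ v → 𝟏 ∷ 𝟏 ∷ zeros a ++ 𝟏 ∷ 𝟏 ∷ v) (trans (zeros-++-++ a c c []) (++-identityʳ _)))
        (interleaving⇒shuffleSquare
          (consˡ (consˡ (zerosˡ a (consʳ (consʳ (zerosʳ a (zerosˡ c (zerosʳ c [])))))))))

twoBlocks-square : ∀ j m m′ j′ e e′ →
  ShuffleSquare (necklace (m ∷ j + m ∷ j + m′ + (e + e) ∷ m′ + j′ ∷ []) (zeros (j′ + (e′ + e′))))
twoBlocks-square j m m′ j′ e e′ =
  subst ShuffleSquare normalise
        (interleaving⇒shuffleSquare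
          (zerosˡ m (consˡ (zerosˡ j (zerosʳ m (consʳ (zerosʳ j (zerosˡ e (zerosʳ e
          (zerosˡ m′ (consˡ (zerosʳ m′ (zerosˡ j′ (consʳ (zerosʳ j′ (zerosˡ e′ (zerosʳ e′ [])))))))))))))))))
  where
  gap₂ : ∀ w → zeros j ++ zeros e ++ zeros e ++ zeros m′ ++ w ≡ zeros (j + m′ + (e + e)) ++ w
  gap₂ w = trans (zeros-++-++ j e e _)
                 (trans (zeros-++ (j + (e + e)) m′ w)
                        (cong (λ k → zeros k ++ w) (xy∙z≈xz∙y +-commutativeSemigroup j (e + e) m′)))
  normalise :
    zeros m ++ 𝟏 ∷ zeros j ++ zeros m ++ 𝟏 ∷ zeros j ++ zeros e ++ zeros e ++ zeros m′ ++
      𝟏 ∷ zeros m′ ++ zeros j′ ++ 𝟏 ∷ zeros j′ ++ zeros e′ ++ zeros e′ ++ []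
    ≡ necklace (m ∷ j + m ∷ j + m′ + (e + e) ∷ m′ + j′ ∷ []) (zeros (j′ + (e′ + e′)))
  normalise =
    cong (necklace (m ∷ [])) (trans (zeros-++ j m _)
      (cong (necklace (j + m ∷ [])) (trans (gap₂ _)
        (cong (necklace (j + m′ + (e + e) ∷ [])) (trans (zeros-++ m′ j′ _)
          (cong (necklace (m′ + j′ ∷ [])) (trans (zeros-++-++ j′ e′ e′ []) (++-identityʳ _))))))))

hasSquareShift-absorbed : ∀ z g gs → ShuffleSquare (necklace (g ∷ gs) (zeros z)) →
  HasSquareShift (necklace (g + z ∷ gs) [])
hasSquareShift-absorbed z g gs square = _ , shift-sym (necklace-absorb z g gs) , square

hasSquareShift-pairs : ∀ a c → HasSquareShift (necklace (0 ∷ a ∷ 0 ∷ a + (c + c) ∷ []) [])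
hasSquareShift-pairs a c =
  hasSquareShift-shift (necklace-rotate (0 ∷ a ∷ 0 ∷ []) (a + (c + c) ∷ []))
    (hasSquareShift-absorbed (a + (c + c)) 0 (0 ∷ a ∷ 0 ∷ []) (pairs-square a c))

hasSquareShift-twoBlocks : ∀ j m m′ j′ e e′ →
  HasSquareShift (necklace (j + m ∷ j + m′ + (e + e) ∷ m′ + j′ ∷ m + j′ + (e′ + e′) ∷ []) [])
hasSquareShift-twoBlocks j m m′ j′ e e′ =
  subst (λ k → HasSquareShift (necklace (j + m ∷ j + m′ + (e + e) ∷ m′ + j′ ∷ k ∷ []) []))
    (sym (+-assoc m j′ (e′ + e′)))
    (hasSquareShift-shift
      (necklace-rotate (j + m ∷ j + m′ + (e + e) ∷ m′ + j′ ∷ []) (m + (j′ + (e′ + e′)) ∷ []))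
      (hasSquareShift-absorbed (j′ + (e′ + e′)) m (j + m ∷ j + m′ + (e + e) ∷ m′ + j′ ∷ [])
        (twoBlocks-square j m m′ j′ e e′)))

hasSquareShift-adjacentOnes : ∀ b d → 2 ∣ b + d → HasSquareShift (necklace (0 ∷ b ∷ 0 ∷ d ∷ []) [])
hasSquareShift-adjacentOnes b d 2∣b+d with ≤-total b d
... | inj₁ b≤d with t , refl ← even-surplus b≤d 2∣b+d = hasSquareShift-pairs b t
... | inj₂ d≤b with t , refl ← even-surplus d≤b (subst (2 ∣_) (+-comm b d) 2∣b+d) =
  hasSquareShift-shift (necklace-rotate (0 ∷ b ∷ []) (0 ∷ d ∷ [])) (hasSquareShift-pairs d t)

sum-alternating : ∀ a b c d → sum (a ∷ b ∷ c ∷ d ∷ []) ≡ (a + c) + (b + d)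
sum-alternating a b c d = begin
  a + (b + (c + (d + 0))) ≡⟨ cong (λ k → a + (b + (c + k))) (+-identityʳ d) ⟩
  a + (b + (c + d))       ≡⟨ cong (a +_) (x∙yz≈y∙xz +-commutativeSemigroup b c d) ⟩
  a + (c + (b + d))       ≡⟨ +-assoc a c (b + d) ⟨
  (a + c) + (b + d)       ∎
  where open ≡-Reasoning

hasSquareShift-balanced : ∀ a b c d → a + c ≤ b + d → 2 ∣ sum (a ∷ b ∷ c ∷ d ∷ []) →
  HasSquareShift (necklace (a ∷ b ∷ c ∷ d ∷ []) [])
hasSquareShift-balanced a b c d a+c≤b+d 2∣sum
  with t , b+d≡ ← even-surplus a+c≤b+d (subst (2 ∣_) (sum-alternating a b c d) 2∣sum)
  with distribute (a + c) b d t b+d≡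
... | inj₁ (distribution s r e e′ s+r≡a+c refl refl)
  with table j m m′ j′ refl refl refl refl ← table-with-margins a c s r s+r≡a+c
  = hasSquareShift-twoBlocks j m m′ j′ e e′
... | inj₂ (a+c≡0 , _) with refl ← m+n≡0⇒m≡0 a a+c≡0 | refl ← m+n≡0⇒n≡0 a a+c≡0 =
  hasSquareShift-adjacentOnes b d (subst (2 ∣_) (sym b+d≡) (2∣n+n t))

hasSquareShift-four : ∀ a b c d → 2 ∣ sum (a ∷ b ∷ c ∷ d ∷ []) →
  HasSquareShift (necklace (a ∷ b ∷ c ∷ d ∷ []) [])
hasSquareShift-four a b c d 2∣sum with ≤-total (a + c) (b + d)
... | inj₁ a+c≤b+d = hasSquareShift-balanced a b c d a+c≤b+d 2∣sum
... | inj₂ b+d≤a+c =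
  hasSquareShift-shift (necklace-rotate (a ∷ []) (b ∷ c ∷ d ∷ []))
    (hasSquareShift-balanced b c d a (subst (b + d ≤_) (+-comm a c) b+d≤a+c)
      (subst (2 ∣_) (sum-rotate (a ∷ []) (b ∷ c ∷ d ∷ [])) 2∣sum))

hasSquareShift-descending : ∀ p q → q ≤ p → 2 ∣ q + p → HasSquareShift (necklace (p ∷ q ∷ []) [])
hasSquareShift-descending p q q≤p 2∣q+p with t , refl ← even-surplus q≤p 2∣q+p =
  subst (λ k → HasSquareShift (necklace (k ∷ q ∷ []) []))
    (sym (trans (+-comm q (t + t)) (+-assoc t t q)))
    (square⇒hasSquareShift (oneBlock-square q t))

hasSquareShift-two : ∀ p q → 2 ∣ p + q → HasSquareShift (necklace (p ∷ q ∷ []) [])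
hasSquareShift-two p q 2∣p+q with ≤-total q p
... | inj₁ q≤p = hasSquareShift-descending p q q≤p (subst (2 ∣_) (+-comm p q) 2∣p+q)
... | inj₂ p≤q =
  hasSquareShift-shift (necklace-rotate (p ∷ []) (q ∷ [])) (hasSquareShift-descending q p p≤q 2∣p+q)

hasSquareShift-necklace : ∀ gs → 2 ∣ length gs → length gs ≤ 4 → 2 ∣ sum gs →
  HasSquareShift (necklace gs [])
hasSquareShift-necklace [] _ _ _ = square⇒hasSquareShift ([] , refl , refl)
hasSquareShift-necklace (_ ∷ []) 2∣1 _ _ with () ← ¬2∣1 2∣1
hasSquareShift-necklace (p ∷ q ∷ []) _ _ 2∣sum =
  hasSquareShift-two p q (subst (2 ∣_) (cong (p +_) (+-identityʳ q)) 2∣sum)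
hasSquareShift-necklace (_ ∷ _ ∷ _ ∷ []) 2∣3 _ _ with () ← ¬2∣3 2∣3
hasSquareShift-necklace (a ∷ b ∷ c ∷ d ∷ []) _ _ 2∣sum = hasSquareShift-four a b c d 2∣sum
hasSquareShift-necklace (_ ∷ _ ∷ _ ∷ _ ∷ _ ∷ _) _ (s≤s (s≤s (s≤s (s≤s ())))) _

proposition3 : (W : Word) → Even W → count 𝟏 W ≤ 4 →
    Σ Word λ V → IsCyclicShiftOf V W × ShuffleSquare V
proposition3 W even ones≤4 with necklace-decomposition W
... | [] , z , refl , _ , c₀ with h , refl ← halve (subst (2 ∣_) c₀ (even 𝟎)) =
  square⇒hasSquareShift (zeros-square h)
... | g ∷ gs , z , refl , c₁ , c₀ =
  hasSquareShift-shift (necklace-absorb z g gs)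
    (hasSquareShift-necklace (g + z ∷ gs) (subst (2 ∣_) c₁ (even 𝟏)) (subst (_≤ 4) c₁ ones≤4)
      (subst (2 ∣_) (trans c₀ (sym (sum-absorb g gs z))) (even 𝟎)))
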